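{- Let $A=\{a_1\le\dots\le a_n\}$ be a sorted multiset of positive integers. Then \[\mathrm{OPT}(A)=\min_{k\le j\le n}\mathrm{OPT_L}\bigl(A[1,j]\bigr).\]
   Context: $k\ge2$ is a fixed integer, $[n]=\{1,\dots,n\}$, $\Sigma(S,A)=\sum_{i\in S}a_i$. For pairwise disjoint $S_1,\dots,S_k\subseteq[n]$, with $M=\max_i\Sigma(S_i,A)$, $m=\min_i\Sigma(S_i,A)$, the ratio $\mathcal{R}(S_1,\dots,S_k,A)$ is $M/m$ if $m>0$ and $+\infty$ otherwise. $\mathrm{OPT}(A)$ is the minimum of $\mathcal{R}(S_1,\dots,S_k,A)$ over pairwise disjoint $S_1,\dots,S_k\subseteq[n]$ ($k$-SSR). $\mathrm{OPT_L}(A)$ is the same minimum under the additional constraint $n\in\bigcup_{i=1}^kS_i$, i.e. the solution must use the largest element ($k$-SSR$_L$). $A[l,r]$ denotes the sorted sub-multiset consisting of the items $a_i$ with $l\le i\le r$. A minimum over an empty range is $+\infty$. -}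

module Defs where

open import Data.Bool using (Bool; true; false; _∧_; _∨_; not; if_then_else_)
open import Data.Nat using (ℕ; zero; suc; _+_; _⊔_; _⊓_; _≤ᵇ_)
open import Data.List using (List; []; _∷_; length; map; foldr; concatMap; take; upTo)
open import Data.Vec using (Vec; []; _∷_)
open import Data.Integer using (+_)
open import Data.Rational using (ℚ) renaming (_/_ to _÷ℚ_; _⊓_ to _⊓ℚ_)

data ℚ∞ : Set where
  fin : ℚ → ℚ∞
  ∞   : ℚ∞

_⊓∞_ : ℚ∞ → ℚ∞ → ℚ∞
fin p ⊓∞ fin q = fin (p ⊓ℚ q)
fin p ⊓∞ ∞     = fin p
∞     ⊓∞ q     = q

min∞ : List ℚ∞ → ℚ∞
min∞ = foldr _⊓∞_ ∞

-- A multiset A = a_1 ≤ … ≤ a_n is a list of naturals (index i ↦ a_i).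
-- A subset S ⊆ [n] is its characteristic vector (true = i ∈ S).
Subset : ℕ → Set
Subset n = Vec Bool n

Σ : (A : List ℕ) → Subset (length A) → ℕ
Σ []       []           = 0
Σ (a ∷ as) (true  ∷ s)  = a + Σ as s
Σ (a ∷ as) (false ∷ s)  = Σ as s

disjointᵇ : ∀ {n} → Subset n → Subset n → Bool
disjointᵇ []      []      = true
disjointᵇ (x ∷ p) (y ∷ q) = not (x ∧ y) ∧ disjointᵇ p q

allᵛ : ∀ {A : Set} {k} → (A → Bool) → Vec A k → Bool
allᵛ f []       = true
allᵛ f (x ∷ xs) = f x ∧ allᵛ f xs

anyᵛ : ∀ {A : Set} {k} → (A → Bool) → Vec A k → Bool
anyᵛ f []       = false
anyᵛ f (x ∷ xs) = f x ∨ anyᵛ f xs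

pairwiseDisjointᵇ : ∀ {n k} → Vec (Subset n) k → Bool
pairwiseDisjointᵇ []       = true
pairwiseDisjointᵇ (s ∷ ss) = allᵛ (disjointᵇ s) ss ∧ pairwiseDisjointᵇ ss

lastᵇ : ∀ {n} → Subset n → Bool
lastᵇ []          = false
lastᵇ (x ∷ [])    = x
lastᵇ (x ∷ y ∷ s) = lastᵇ (y ∷ s)

usesLastᵇ : ∀ {n k} → Vec (Subset n) k → Bool
usesLastᵇ = anyᵛ lastᵇ

allVecs : ∀ {A : Set} → List A → (k : ℕ) → List (Vec A k)
allVecs xs zero    = [] ∷ []
allVecs xs (suc k) = concatMap (λ x → map (x ∷_) (allVecs xs k)) xs

allSubsets : (n : ℕ) → List (Subset n)
allSubsets n = allVecs (true ∷ false ∷ []) n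

allTuples : (n k : ℕ) → List (Vec (Subset n) k)
allTuples n k = allVecs (allSubsets n) k

maxᵛ : ∀ {k} → Vec ℕ k → ℕ
maxᵛ []       = 0
maxᵛ (x ∷ xs) = x ⊔ maxᵛ xs

-- minimum of a vector (only used for k ≥ 2, the value at k = 0 is irrelevant)
minᵛ : ∀ {k} → Vec ℕ k → ℕ
minᵛ []           = 0
minᵛ (x ∷ [])     = x
minᵛ (x ∷ y ∷ xs) = x ⊓ minᵛ (y ∷ xs)

mapᵛ : ∀ {A B : Set} {k} → (A → B) → Vec A k → Vec B k
mapᵛ f []       = []
mapᵛ f (x ∷ xs) = f x ∷ mapᵛ f xs

ratioℕ : ℕ → ℕ → ℚ∞
ratioℕ M zero    = ∞
ratioℕ M (suc m) = fin ((+ M) ÷ℚ suc m)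

𝓡 : ∀ {k} (A : List ℕ) → Vec (Subset (length A)) k → ℚ∞
𝓡 A S = ratioℕ (maxᵛ sums) (minᵛ sums)
  where sums = mapᵛ (Σ A) S

OPT : (k : ℕ) → List ℕ → ℚ∞
OPT k A = min∞ (map (λ S → if pairwiseDisjointᵇ S then 𝓡 A S else ∞)
                    (allTuples (length A) k))

OPT-L : (k : ℕ) → List ℕ → ℚ∞
OPT-L k A = min∞ (map (λ S → if pairwiseDisjointᵇ S ∧ usesLastᵇ S then 𝓡 A S else ∞)
                      (allTuples (length A) k))

prefix : ℕ → List ℕ → List ℕ
prefix j A = take j A

minPrefixOPT-L : (k : ℕ) → List ℕ → ℚ∞
minPrefixOPT-L k A =
  min∞ (map (λ j → if k ≤ᵇ j then OPT-L k (prefix j A) else ∞) (upTo (suc (length A))))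

-- Take any family of k disjoint sets with positive sums (a family whose minimum sum
-- is 0 has ratio +∞ and is irrelevant) and let j be the largest index it uses. Cutting
-- every set down to [1, j] keeps all the sums, hence the ratio, and now the family uses the
-- last item of A[1, j]; moreover j ≥ k, because k disjoint nonempty sets need k distinct
-- indices. Conversely a family for A[1, j] is one for A as well.
module Submission where

open import Defs
open import Data.Nat using (ℕ; _≤_; _<_)
open import Data.Nat.Properties using (≤-totalOrder)
open import Data.List using (List)
open import Data.List.Relation.Unary.All using (All)
open import Data.List.Relation.Unary.Sorted.TotalOrder ≤-totalOrder using (Sorted)
open import Relation.Binary.PropositionalEquality using (_≡_)

open import Data.Bool using (Bool; true; false; _∧_; _∨_; not; if_then_else_)
open import Data.Bool.Properties using (T-≡)
open import Data.Nat using (zero; suc; _+_; _≤ᵇ_; z≤n; s≤s)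
open import Data.Nat.Properties
  using (≤-refl; ≤-trans; ≤-reflexive; n≤1+n; m⊓n≤m; m⊓n≤n; +-mono-≤; +-suc; <-irrefl; ≤⇒≤ᵇ)
open import Data.Vec as Vec using (Vec; []; _∷_; head)
open import Data.Vec.Relation.Unary.All using ([]; _∷_; universal) renaming (All to Allᵛ)
open import Data.List using ([]; _∷_; map; length; take; upTo)
open import Data.List.Properties using (length-take)
open import Data.List.Membership.Propositional using (_∈_; lose)
open import Data.List.Membership.Propositional.Properties using (∈-map⁺; ∈-concatMap⁺; ∈-upTo⁺)
open import Data.List.Relation.Unary.Any using (here; there)
import Data.Rational as ℚ
import Data.Rational.Properties as ℚ
open import Data.Product using (_×_; _,_; ∃)
open import Data.Sum using (_⊎_; inj₁; inj₂)
open import Data.Empty using (⊥-elim)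
open import Data.Unit using (⊤)
open import Function using (Equivalence)
open import Relation.Binary.PropositionalEquality using (refl; sym; trans; cong; cong₂; subst; isEquivalence)
open import Relation.Binary.Bundles using (Preorder)
import Relation.Binary.Reasoning.Preorder as PreorderReasoning

infix 4 _≤∞_

data _≤∞_ : ℚ∞ → ℚ∞ → Set where
  fin≤fin : ∀ {p q} → p ℚ.≤ q → fin p ≤∞ fin q
  _≤∞∞    : ∀ x → x ≤∞ ∞

≤∞-refl : ∀ {x} → x ≤∞ x
≤∞-refl {fin p} = fin≤fin ℚ.≤-refl
≤∞-refl {∞}     = ∞ ≤∞∞

≤∞-reflexive : ∀ {x y} → x ≡ y → x ≤∞ y
≤∞-reflexive refl = ≤∞-refl

≤∞-trans : ∀ {x y z} → x ≤∞ y → y ≤∞ z → x ≤∞ z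
≤∞-trans (fin≤fin p≤q) (fin≤fin q≤r) = fin≤fin (ℚ.≤-trans p≤q q≤r)
≤∞-trans _             (y ≤∞∞)       = _ ≤∞∞

≤∞-antisym : ∀ {x y} → x ≤∞ y → y ≤∞ x → x ≡ y
≤∞-antisym (fin≤fin p≤q) (fin≤fin q≤p) = cong fin (ℚ.≤-antisym p≤q q≤p)
≤∞-antisym (_ ≤∞∞)       (_ ≤∞∞)       = refl

≤∞-preorder : Preorder _ _ _
≤∞-preorder = record
  { isPreorder = record { isEquivalence = isEquivalence ; reflexive = ≤∞-reflexive ; trans = ≤∞-trans } }

module ≤∞-Reasoning = PreorderReasoning ≤∞-preorder

x⊓∞y≤∞x : ∀ x y → x ⊓∞ y ≤∞ x
x⊓∞y≤∞x (fin p) (fin q) = fin≤fin (ℚ.p⊓q≤p p q)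
x⊓∞y≤∞x (fin p) ∞       = ≤∞-refl
x⊓∞y≤∞x ∞       y       = _ ≤∞∞

x⊓∞y≤∞y : ∀ x y → x ⊓∞ y ≤∞ y
x⊓∞y≤∞y (fin p) (fin q) = fin≤fin (ℚ.p⊓q≤q p q)
x⊓∞y≤∞y (fin p) ∞       = _ ≤∞∞
x⊓∞y≤∞y ∞       y       = ≤∞-refl

⊓∞-glb : ∀ {z} x y → z ≤∞ x → z ≤∞ y → z ≤∞ x ⊓∞ y
⊓∞-glb (fin p) (fin q) (fin≤fin z≤p) (fin≤fin z≤q) = fin≤fin (ℚ.⊓-glb z≤p z≤q)
⊓∞-glb (fin p) ∞       z≤x           _             = z≤x
⊓∞-glb ∞       y       _             z≤y           = z≤y

≤∞-if : ∀ {x r} b → x ≤∞ r → x ≤∞ (if b then r else ∞)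
≤∞-if true  x≤r = x≤r
≤∞-if false _   = _ ≤∞∞

module _ {X : Set} (f : X → ℚ∞) where

  min∞-map-≤∞ : ∀ {y ys} → y ∈ ys → min∞ (map f ys) ≤∞ f y
  min∞-map-≤∞ {ys = y ∷ _} (here refl) = x⊓∞y≤∞x (f y) _
  min∞-map-≤∞ {ys = y ∷ _} (there y∈ys) = ≤∞-trans (x⊓∞y≤∞y (f y) _) (min∞-map-≤∞ y∈ys)

  ≤∞-min∞-map : ∀ {z} ys → (∀ y → z ≤∞ f y) → z ≤∞ min∞ (map f ys)
  ≤∞-min∞-map []       _  = _ ≤∞∞
  ≤∞-min∞-map (y ∷ ys) lb = ⊓∞-glb (f y) _ (lb y) (≤∞-min∞-map ys lb)

∈-allVecs : ∀ {X : Set} {xs : List X} → (∀ x → x ∈ xs) → ∀ {k} (v : Vec X k) → v ∈ allVecs xs k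
∈-allVecs every []      = here refl
∈-allVecs every (x ∷ v) = ∈-concatMap⁺ _ (lose (every x) (∈-map⁺ (x ∷_) (∈-allVecs every v)))

∈-allTuples : ∀ n k (S : Vec (Subset n) k) → S ∈ allTuples n k
∈-allTuples n k = ∈-allVecs (∈-allVecs every-bool)
  where
  every-bool : ∀ b → b ∈ true ∷ false ∷ []
  every-bool true  = here refl
  every-bool false = there (here refl)

OPT-≤∞-𝓡 : ∀ k A (S : Vec (Subset (length A)) k) → pairwiseDisjointᵇ S ≡ true → OPT k A ≤∞ 𝓡 A S
OPT-≤∞-𝓡 k A S disj = ≤∞-trans
  (min∞-map-≤∞ (λ S → if pairwiseDisjointᵇ S then 𝓡 A S else ∞) (∈-allTuples (length A) k S))
  (≤∞-reflexive (cong (λ b → if b then 𝓡 A S else ∞) disj))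

OPT-L-≤∞-𝓡 : ∀ k A (S : Vec (Subset (length A)) k) →
  pairwiseDisjointᵇ S ≡ true → usesLastᵇ S ≡ true → OPT-L k A ≤∞ 𝓡 A S
OPT-L-≤∞-𝓡 k A S disj last = ≤∞-trans
  (min∞-map-≤∞ (λ S → if pairwiseDisjointᵇ S ∧ usesLastᵇ S then 𝓡 A S else ∞)
               (∈-allTuples (length A) k S))
  (≤∞-reflexive (cong (λ b → if b then 𝓡 A S else ∞) (cong₂ _∧_ disj last)))

𝓡-cong : ∀ {k} A B {S : Vec (Subset (length A)) k} {T : Vec (Subset (length B)) k} →
  mapᵛ (Σ A) S ≡ mapᵛ (Σ B) T → 𝓡 A S ≡ 𝓡 B T
𝓡-cong A B sums≡ = cong (λ v → ratioℕ (maxᵛ v) (minᵛ v)) sums≡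

∧≡true⇒ : ∀ {b c} → b ∧ c ≡ true → b ≡ true × c ≡ true
∧≡true⇒ {true} {true} _ = refl , refl

∨≡false⇒ : ∀ {b c} → b ∨ c ≡ false → b ≡ false × c ≡ false
∨≡false⇒ {false} {false} _ = refl , refl

module _ {n m : ℕ} (f : Subset n → Subset m)
         (f-disjoint : ∀ s t → disjointᵇ s t ≡ true → disjointᵇ (f s) (f t) ≡ true) where

  allᵛ-disjointᵇ-mapᵛ : ∀ {k} s (T : Vec (Subset n) k) →
    allᵛ (disjointᵇ s) T ≡ true → allᵛ (disjointᵇ (f s)) (mapᵛ f T) ≡ true
  allᵛ-disjointᵇ-mapᵛ s []      _    = refl
  allᵛ-disjointᵇ-mapᵛ s (t ∷ T) disj with ∧≡true⇒ {disjointᵇ s t} disj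
  ... | s#t , s#T = cong₂ _∧_ (f-disjoint s t s#t) (allᵛ-disjointᵇ-mapᵛ s T s#T)

  pairwiseDisjointᵇ-mapᵛ : ∀ {k} (S : Vec (Subset n) k) →
    pairwiseDisjointᵇ S ≡ true → pairwiseDisjointᵇ (mapᵛ f S) ≡ true
  pairwiseDisjointᵇ-mapᵛ []      _    = refl
  pairwiseDisjointᵇ-mapᵛ (s ∷ S) disj with ∧≡true⇒ {allᵛ (disjointᵇ s) S} disj
  ... | s#S , S# = cong₂ _∧_ (allᵛ-disjointᵇ-mapᵛ s S s#S) (pairwiseDisjointᵇ-mapᵛ S S#)

∅ : ∀ n → Subset n
∅ zero    = []
∅ (suc n) = false ∷ ∅ n

Σ-∅ : ∀ A → Σ A (∅ (length A)) ≡ 0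
Σ-∅ []      = refl
Σ-∅ (_ ∷ A) = Σ-∅ A

disjointᵇ-∅ʳ : ∀ {n} (s : Subset n) → disjointᵇ s (∅ n) ≡ true
disjointᵇ-∅ʳ []          = refl
disjointᵇ-∅ʳ (true ∷ s)  = disjointᵇ-∅ʳ s
disjointᵇ-∅ʳ (false ∷ s) = disjointᵇ-∅ʳ s

extend : (j : ℕ) (A : List ℕ) → Subset (length (take j A)) → Subset (length A)
extend zero    A        []      = ∅ (length A)
extend (suc j) []       []      = []
extend (suc j) (_ ∷ A)  (x ∷ s) = x ∷ extend j A s

Σ-extend : ∀ j A s → Σ A (extend j A s) ≡ Σ (take j A) s
Σ-extend zero    A       []          = Σ-∅ A
Σ-extend (suc j) []      []          = refl
Σ-extend (suc j) (a ∷ A) (true ∷ s)  = cong (a +_) (Σ-extend j A s)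
Σ-extend (suc j) (a ∷ A) (false ∷ s) = Σ-extend j A s

mapᵛ-Σ-extend : ∀ {k} j A (S : Vec (Subset (length (take j A))) k) →
  mapᵛ (Σ A) (mapᵛ (extend j A) S) ≡ mapᵛ (Σ (take j A)) S
mapᵛ-Σ-extend j A []      = refl
mapᵛ-Σ-extend j A (s ∷ S) = cong₂ Vec._∷_ (Σ-extend j A s) (mapᵛ-Σ-extend j A S)

disjointᵇ-extend : ∀ j A s t → disjointᵇ s t ≡ true → disjointᵇ (extend j A s) (extend j A t) ≡ true
disjointᵇ-extend zero    A       []      []      _    = disjointᵇ-∅ʳ (∅ (length A))
disjointᵇ-extend (suc j) []      []      []      _    = refl
disjointᵇ-extend (suc j) (_ ∷ A) (x ∷ s) (y ∷ t) disj with ∧≡true⇒ {not (x ∧ y)} disj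
... | x#y , s#t = cong₂ _∧_ x#y (disjointᵇ-extend j A s t s#t)

restrict : (j : ℕ) (A : List ℕ) → Subset (length A) → Subset (length (take j A))
restrict zero    A       s       = []
restrict (suc j) []      []      = []
restrict (suc j) (_ ∷ A) (x ∷ s) = x ∷ restrict j A s

disjointᵇ-restrict : ∀ j A s t → disjointᵇ s t ≡ true → disjointᵇ (restrict j A s) (restrict j A t) ≡ true
disjointᵇ-restrict zero    A       s       t       _    = refl
disjointᵇ-restrict (suc j) []      []      []      _    = refl
disjointᵇ-restrict (suc j) (_ ∷ A) (x ∷ s) (y ∷ t) disj with ∧≡true⇒ {not (x ∧ y)} disj
... | x#y , s#t = cong₂ _∧_ x#y (disjointᵇ-restrict j A s t s#t)

-- Indices are 0-based: s ∋? j tests item a_{j+1}, and VanishesFrom j s says s ⊆ [1, j].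
_∋?_ : ∀ {n} → Subset n → ℕ → Bool
[]      ∋? _     = false
(x ∷ s) ∋? zero  = x
(x ∷ s) ∋? suc j = s ∋? j

VanishesFrom : ∀ {n} → ℕ → Subset n → Set
VanishesFrom {n} zero    s       = s ≡ ∅ n
VanishesFrom     (suc j) []      = ⊤
VanishesFrom     (suc j) (_ ∷ s) = VanishesFrom j s

vanishesFrom-length : ∀ {n} (s : Subset n) → VanishesFrom n s
vanishesFrom-length []      = refl
vanishesFrom-length (_ ∷ s) = vanishesFrom-length s

vanishesFrom-pred : ∀ {n} j (s : Subset n) → VanishesFrom (suc j) s → s ∋? j ≡ false → VanishesFrom j s
vanishesFrom-pred zero    []      _    _    = refl
vanishesFrom-pred zero    (_ ∷ s) s≡∅  x≡ff = cong₂ Vec._∷_ x≡ff s≡∅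
vanishesFrom-pred (suc j) []      _    _    = _
vanishesFrom-pred (suc j) (_ ∷ s) van  j∉s = vanishesFrom-pred j s van j∉s

Σ-restrict : ∀ j A s → VanishesFrom j s → Σ (take j A) (restrict j A s) ≡ Σ A s
Σ-restrict zero    A       s           s≡∅ = trans (sym (Σ-∅ A)) (cong (Σ A) (sym s≡∅))
Σ-restrict (suc j) []      []          _   = refl
Σ-restrict (suc j) (a ∷ A) (true ∷ s)  van = cong (a +_) (Σ-restrict j A s van)
Σ-restrict (suc j) (a ∷ A) (false ∷ s) van = Σ-restrict j A s van

mapᵛ-Σ-restrict : ∀ {k} j A (S : Vec (Subset (length A)) k) → Allᵛ (VanishesFrom j) S →
  mapᵛ (Σ (take j A)) (mapᵛ (restrict j A) S) ≡ mapᵛ (Σ A) S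
mapᵛ-Σ-restrict j A []      []           = refl
mapᵛ-Σ-restrict j A (s ∷ S) (van ∷ vans) = cong₂ Vec._∷_ (Σ-restrict j A s van) (mapᵛ-Σ-restrict j A S vans)

lastᵇ-restrict : ∀ j A s → suc j ≤ length A → lastᵇ (restrict (suc j) A s) ≡ s ∋? j
lastᵇ-restrict zero    (_ ∷ A)     (_ ∷ s)     _         = refl
lastᵇ-restrict (suc j) (_ ∷ [])    (_ ∷ s)     (s≤s ())
lastᵇ-restrict (suc j) (_ ∷ b ∷ A) (_ ∷ y ∷ s) (s≤s j<n) = lastᵇ-restrict j (b ∷ A) (y ∷ s) j<n

usesLastᵇ-restrict : ∀ {k} j A (S : Vec (Subset (length A)) k) → suc j ≤ length A →
  usesLastᵇ (mapᵛ (restrict (suc j) A) S) ≡ anyᵛ (_∋? j) S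
usesLastᵇ-restrict j A []      _   = refl
usesLastᵇ-restrict j A (s ∷ S) j<n = cong₂ _∨_ (lastᵇ-restrict j A s j<n) (usesLastᵇ-restrict j A S j<n)

allVanishFrom-pred : ∀ {n k} j (S : Vec (Subset n) k) → Allᵛ (VanishesFrom (suc j)) S →
  anyᵛ (_∋? j) S ≡ false → Allᵛ (VanishesFrom j) S
allVanishFrom-pred j []      []           _      = []
allVanishFrom-pred j (s ∷ S) (van ∷ vans) unused with ∨≡false⇒ {s ∋? j} unused
... | j∉s , j∉S = vanishesFrom-pred j s van j∉s ∷ allVanishFrom-pred j S vans j∉S

lastUsedPrefix : ∀ {k} A (S : Vec (Subset (length A)) (suc k)) → 0 < Σ A (head S) →
  ∀ j → j ≤ length A → Allᵛ (VanishesFrom j) S →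
  ∃ λ i → i ≤ length A × Allᵛ (VanishesFrom i) S × usesLastᵇ (mapᵛ (restrict i A) S) ≡ true
lastUsedPrefix A (s ∷ S) Σs>0 zero _ (s≡∅ ∷ _) =
  ⊥-elim (<-irrefl refl (subst (0 <_) (trans (cong (Σ A) s≡∅) (Σ-∅ A)) Σs>0))
lastUsedPrefix A S Σs>0 (suc j) j<n vans with anyᵛ (_∋? j) S in used
... | true  = suc j , j<n , vans , trans (usesLastᵇ-restrict j A S j<n) used
... | false = lastUsedPrefix A S Σs>0 j (≤-trans (n≤1+n j) j<n) (allVanishFrom-pred j S vans used)

count : ∀ {n} → Subset n → ℕ
count []          = 0
count (true ∷ s)  = suc (count s)
count (false ∷ s) = count s

count≤n : ∀ {n} (s : Subset n) → count s ≤ n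
count≤n []          = z≤n
count≤n (true ∷ s)  = s≤s (count≤n s)
count≤n (false ∷ s) = ≤-trans (count≤n s) (n≤1+n _)

0<Σ⇒0<count : ∀ A (s : Subset (length A)) → 0 < Σ A s → 0 < count s
0<Σ⇒0<count []      []          ()
0<Σ⇒0<count (_ ∷ A) (true ∷ s)  _    = s≤s z≤n
0<Σ⇒0<count (_ ∷ A) (false ∷ s) Σs>0 = 0<Σ⇒0<count A s Σs>0

_∪_ : ∀ {n} → Subset n → Subset n → Subset n
[]      ∪ []      = []
(x ∷ s) ∪ (y ∷ t) = (x ∨ y) ∷ (s ∪ t)

⋃ : ∀ {n k} → Vec (Subset n) k → Subset n
⋃ {n} []      = ∅ n
⋃     (s ∷ S) = s ∪ ⋃ S

count-∪ : ∀ {n} (s t : Subset n) → disjointᵇ s t ≡ true → count (s ∪ t) ≡ count s + count t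
count-∪ []          []          _    = refl
count-∪ (true ∷ s)  (false ∷ t) disj = cong suc (count-∪ s t disj)
count-∪ (false ∷ s) (true ∷ t)  disj = trans (cong suc (count-∪ s t disj)) (sym (+-suc (count s) (count t)))
count-∪ (false ∷ s) (false ∷ t) disj = count-∪ s t disj

disjointᵇ-∪ : ∀ {n} (s t u : Subset n) →
  disjointᵇ s t ≡ true → disjointᵇ s u ≡ true → disjointᵇ s (t ∪ u) ≡ true
disjointᵇ-∪ []          []          []          _    _    = refl
disjointᵇ-∪ (false ∷ s) (_ ∷ t)     (_ ∷ u)     s#t  s#u  = disjointᵇ-∪ s t u s#t s#u
disjointᵇ-∪ (true ∷ s)  (false ∷ t) (false ∷ u) s#t  s#u  = disjointᵇ-∪ s t u s#t s#u

disjointᵇ-⋃ : ∀ {n k} (s : Subset n) (T : Vec (Subset n) k) →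
  allᵛ (disjointᵇ s) T ≡ true → disjointᵇ s (⋃ T) ≡ true
disjointᵇ-⋃ s []      _    = disjointᵇ-∅ʳ s
disjointᵇ-⋃ s (t ∷ T) disj with ∧≡true⇒ {disjointᵇ s t} disj
... | s#t , s#T = disjointᵇ-∪ s t (⋃ T) s#t (disjointᵇ-⋃ s T s#T)

k≤count-⋃ : ∀ {k} A (S : Vec (Subset (length A)) k) →
  pairwiseDisjointᵇ S ≡ true → Allᵛ (0 <_) (mapᵛ (Σ A) S) → k ≤ count (⋃ S)
k≤count-⋃ A []      _    _               = z≤n
k≤count-⋃ A (s ∷ S) disj (Σs>0 ∷ ΣS>0) with ∧≡true⇒ {allᵛ (disjointᵇ s) S} disj
... | s#S , S# = subst (_ ≤_) (sym (count-∪ s (⋃ S) (disjointᵇ-⋃ s S s#S)))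
                   (+-mono-≤ (0<Σ⇒0<count A s Σs>0) (k≤count-⋃ A S S# ΣS>0))

k≤length : ∀ {k} A (S : Vec (Subset (length A)) k) →
  pairwiseDisjointᵇ S ≡ true → Allᵛ (0 <_) (mapᵛ (Σ A) S) → k ≤ length A
k≤length A S disj sums>0 = ≤-trans (k≤count-⋃ A S disj sums>0) (count≤n (⋃ S))

0<minᵛ⇒all : ∀ {k} (v : Vec ℕ k) → 0 < minᵛ v → Allᵛ (0 <_) v
0<minᵛ⇒all []          _      = []
0<minᵛ⇒all (x ∷ [])    x>0    = x>0 ∷ []
0<minᵛ⇒all (x ∷ y ∷ v) min>0 =
  ≤-trans min>0 (m⊓n≤m x _) ∷ 0<minᵛ⇒all (y ∷ v) (≤-trans min>0 (m⊓n≤n x _))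

𝓡≡∞⊎sums>0 : ∀ {k} A (S : Vec (Subset (length A)) k) → 𝓡 A S ≡ ∞ ⊎ Allᵛ (0 <_) (mapᵛ (Σ A) S)
𝓡≡∞⊎sums>0 A S with minᵛ (mapᵛ (Σ A) S) in min≡
... | zero  = inj₁ refl
... | suc _ = inj₂ (0<minᵛ⇒all _ (subst (0 <_) (sym min≡) (s≤s z≤n)))

OPT≤∞minPrefixOPT-L : ∀ k A → OPT k A ≤∞ minPrefixOPT-L k A
OPT≤∞minPrefixOPT-L k A = ≤∞-min∞-map _ (upTo (suc (length A))) OPT≤∞prefix
  where
  open ≤∞-Reasoning

  OPT≤∞prefix : ∀ j → OPT k A ≤∞ (if k ≤ᵇ j then OPT-L k (prefix j A) else ∞)
  OPT≤∞prefix j = ≤∞-if (k ≤ᵇ j) (≤∞-min∞-map _ (allTuples (length (take j A)) k) OPT≤∞feasible)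
    where
    OPT≤∞feasible : ∀ S → OPT k A ≤∞ (if pairwiseDisjointᵇ S ∧ usesLastᵇ S then 𝓡 (take j A) S else ∞)
    OPT≤∞feasible S with pairwiseDisjointᵇ S in disj
    ... | false = _ ≤∞∞
    ... | true  = ≤∞-if (usesLastᵇ S) (begin
      OPT k A                           ≲⟨ OPT-≤∞-𝓡 k A (mapᵛ (extend j A) S)
                                             (pairwiseDisjointᵇ-mapᵛ (extend j A) (disjointᵇ-extend j A) S disj) ⟩
      𝓡 A (mapᵛ (extend j A) S)         ≡⟨ 𝓡-cong A (take j A) (mapᵛ-Σ-extend j A S) ⟩
      𝓡 (take j A) S                    ∎)

minPrefixOPT-L≤∞𝓡 : ∀ k A (S : Vec (Subset (length A)) (suc k)) →
  pairwiseDisjointᵇ S ≡ true → Allᵛ (0 <_) (mapᵛ (Σ A) S) → minPrefixOPT-L (suc k) A ≤∞ 𝓡 A S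
minPrefixOPT-L≤∞𝓡 k A S@(s ∷ _) disj sums>0@(Σs>0 ∷ _)
  with j , j≤n , vans , usesLast ← lastUsedPrefix A S Σs>0 (length A) ≤-refl (universal vanishesFrom-length S)
  = begin
  minPrefixOPT-L (suc k) A                                    ≲⟨ min∞-map-≤∞ prefixValue (∈-upTo⁺ (s≤s j≤n)) ⟩
  prefixValue j                                               ≡⟨ cong (λ b → if b then OPT-L (suc k) (take j A) else ∞)
                                                                      (Equivalence.to T-≡ (≤⇒≤ᵇ k<j)) ⟩
  OPT-L (suc k) (take j A)                                    ≲⟨ OPT-L-≤∞-𝓡 (suc k) (take j A) T disjT usesLast ⟩
  𝓡 (take j A) T                                              ≡⟨ 𝓡-cong (take j A) A sums≡ ⟩
  𝓡 A S                                                       ∎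
  where
  open ≤∞-Reasoning

  prefixValue : ℕ → ℚ∞
  prefixValue j = if suc k ≤ᵇ j then OPT-L (suc k) (prefix j A) else ∞

  T = mapᵛ (restrict j A) S
  sums≡ = mapᵛ-Σ-restrict j A S vans
  disjT = pairwiseDisjointᵇ-mapᵛ (restrict j A) (disjointᵇ-restrict j A) S disj

  k<j : suc k ≤ j
  k<j = ≤-trans (k≤length (take j A) T disjT (subst (Allᵛ (0 <_)) (sym sums≡) sums>0))
                (≤-trans (≤-reflexive (length-take j A)) (m⊓n≤m j _))

minPrefixOPT-L≤∞OPT : ∀ k A → minPrefixOPT-L (suc k) A ≤∞ OPT (suc k) A
minPrefixOPT-L≤∞OPT k A = ≤∞-min∞-map _ (allTuples (length A) (suc k)) ≤∞feasible
  where
  ≤∞feasible : ∀ S → minPrefixOPT-L (suc k) A ≤∞ (if pairwiseDisjointᵇ S then 𝓡 A S else ∞)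
  ≤∞feasible S with pairwiseDisjointᵇ S in disj | 𝓡≡∞⊎sums>0 A S
  ... | false | _            = _ ≤∞∞
  ... | true  | inj₁ 𝓡≡∞    = subst (_ ≤∞_) (sym 𝓡≡∞) (_ ≤∞∞)
  ... | true  | inj₂ sums>0 = minPrefixOPT-L≤∞𝓡 k A S disj sums>0

-- Sortedness and positivity of the items are not needed: only the index order matters, and
-- families containing an empty-sum set have ratio +∞ anyway.
lemma25 : (k : ℕ) → 2 ≤ k → (A : List ℕ) → Sorted A → All (0 <_) A →
    OPT k A ≡ minPrefixOPT-L k A
lemma25 (suc k) _ A _ _ = ≤∞-antisym (OPT≤∞minPrefixOPT-L (suc k) A) (minPrefixOPT-L≤∞OPT k A)
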